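{- For all integers $k\geq 2$ and all positive integers $m,n$, \[ M_k(mn)\leq \binom{mn+m-1}{m-1} M_k(n)^m. \]
   Context: Words are finite sequences over the alphabet $[k]=\{1,\dots,k\}$. For words $v\in[k]^m$ and $w\in[k]^n$, a map from $v$ to $w$ is a strictly increasing function $f\colon[m]\to[n]$ with $v[i]=w[f(i)]$ for all $i$; $M(v,w)$ denotes the number of such maps. Let $M(w)=\max_v M(v,w)$ over all words $v$ over $[k]$, and $M_k(n)=\min_{w\in[k]^n} M(w)$. -}

module Defs where

open import Data.Nat using (ℕ; zero; suc; _≤_)
open import Data.Fin using (Fin; _<?_) renaming (_<_ to _<ᶠ_)
open import Data.Fin.Properties using (all?) renaming (_≟_ to _≟ᶠ_)
open import Data.Vec using (Vec; []; _∷_; lookup)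
open import Data.List using (List; []; _∷_; map; concatMap; length; filter; allFin)
open import Data.Product using (Σ; ∃; _×_; _,_)
open import Relation.Nullary using (Dec)
open import Relation.Nullary.Decidable using (_×-dec_; _→-dec_)
open import Relation.Binary.PropositionalEquality using (_≡_)

Word : ℕ → ℕ → Set
Word k n = Vec (Fin k) n

-- All functions [m] → [n], encoded as their tables (Vec (Fin n) m).
allFuns : (m n : ℕ) → List (Vec (Fin n) m)
allFuns zero    n = [] ∷ []
allFuns (suc m) n = concatMap (λ x → map (x ∷_) (allFuns m n)) (allFin n)

IsMap : ∀ {k m n} → Word k m → Word k n → Vec (Fin n) m → Set
IsMap {m = m} v w f =
  ((i j : Fin m) → i <ᶠ j → lookup f i <ᶠ lookup f j) ×
  ((i : Fin m) → lookup v i ≡ lookup w (lookup f i))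

isMap? : ∀ {k m n} (v : Word k m) (w : Word k n) (f : Vec (Fin n) m) → Dec (IsMap v w f)
isMap? v w f =
  all? (λ i → all? (λ j → (i <? j) →-dec (lookup f i <? lookup f j)))
  ×-dec all? (λ i → lookup v i ≟ᶠ lookup w (lookup f i))

M : ∀ {k m n} → Word k m → Word k n → ℕ
M {m = m} {n = n} v w = length (filter (isMap? v w) (allFuns m n))

IsMaxM : ∀ {k n} → Word k n → ℕ → Set
IsMaxM {k} w r =
  (Σ ℕ λ m → Σ (Word k m) λ v → M v w ≡ r) ×
  (∀ m (v : Word k m) → M v w ≤ r)

IsMk : ℕ → ℕ → ℕ → Set
IsMk k n r =
  (Σ (Word k n) λ w → IsMaxM w r) ×
  (∀ (w : Word k n) (s : ℕ) → IsMaxM w s → r ≤ s)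

-- M(v,w) satisfies Pascal's recursion M(xv, yw) = M(xv, w) + [x = y] M(v, w), and splitting
-- w = u u' gives M(v, u u') = ∑_j M(v[..j], u) M(v[j..], u').  If every word embeds into u
-- at most b times, induction on m with the hockey-stick identity yields
-- M(v, u^(m+1)) ≤ C(|v| + m, m) b^(m+1).  Taking u a word of length n with M(u) = M_k(n),
-- M_k(mn) ≤ M(u^m) is then at most C(mn + m - 1, m - 1) M_k(n)^m.
module Submission where

open import Defs
open import Algebra.Properties.CommutativeSemigroup using (x∙yz≈y∙xz)
open import Data.Fin as Fin using (Fin; zero; suc; toℕ; _≟_)
open import Data.List as List using (List; []; _∷_; _++_; length; map; concatMap; filter; tabulate; upTo; take; drop)
open import Data.List.Extrema.Nat using (argmax; f[xs]≤f[argmax])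
open import Data.List.Membership.Propositional using (_∈_; lose)
open import Data.List.Membership.Propositional.Properties using (∈-map⁺; ∈-concatMap⁺; ∈-allFin; ∈-upTo⁺)
open import Data.List.Properties using (length-drop; ++-identityʳ)
open import Data.List.Relation.Unary.Any using (here)
import Data.List.Relation.Unary.All as All
open import Data.Nat using (ℕ; zero; suc; _+_; _*_; _∸_; _^_; _≤_; _<_; z≤n; z<s; s≤s; s<s; s<s⁻¹; _≤?_)
open import Data.Nat.Combinatorics using (_C_; nCn≡1; nCk+nC[k+1]≡[n+1]C[k+1])
open import Data.Nat.Properties hiding (_≟_)
open import Algebra.Properties.Semiring.Sum +-*-semiring
  using (sum; sum-syntax; sum⁺-syntax; sum-cong-≗; ∑-distrib-+; *-distribˡ-sum; *-distribʳ-sum; sum-replicate-zero)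
open import Data.Product using (Σ; ∃; _×_; _,_; proj₁; proj₂)
open import Data.Vec as Vec using (Vec; []; _∷_; lookup; toList; fromList)
open import Data.Vec.Properties using (lookup-map; toList-++; toList∘fromList; length-toList)
open import Function using (_∘_; id; _⇔_; mk⇔; Equivalence)
open import Relation.Binary.Definitions using (DecidableEquality)
open import Relation.Binary.PropositionalEquality
open import Relation.Nullary using (Dec; yes; no; ¬_; contradiction)
open import Relation.Nullary.Decidable using (_×-dec_)
open import Relation.Unary using (Decidable)

private
  variable
    A B : Set
    k m n : ℕ

iverson : {P : Set} → Dec P → ℕ
iverson (yes _) = 1
iverson (no _)  = 0

iverson-cong : {P Q : Set} (p : Dec P) (q : Dec Q) → P ⇔ Q → iverson p ≡ iverson q
iverson-cong (yes _) (yes _) _   = refl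
iverson-cong (no _)  (no _)  _   = refl
iverson-cong (yes p) (no ¬q) P⇔Q = contradiction (Equivalence.to P⇔Q p) ¬q
iverson-cong (no ¬p) (yes q) P⇔Q = contradiction (Equivalence.from P⇔Q q) ¬p

iverson-× : {P Q : Set} (p : Dec P) (q : Dec Q) → iverson (p ×-dec q) ≡ iverson p * iverson q
iverson-× (yes _) (yes _) = refl
iverson-× (yes _) (no _)  = refl
iverson-× (no _)  _       = refl

count : {P : A → Set} → Decidable P → List A → ℕ
count P? []       = 0
count P? (x ∷ xs) = iverson (P? x) + count P? xs

module _ {P : A → Set} (P? : Decidable P) where

  length-filter≡count : ∀ xs → length (filter P? xs) ≡ count P? xs
  length-filter≡count []       = refl
  length-filter≡count (x ∷ xs) with P? x
  ... | yes _ = cong suc (length-filter≡count xs)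
  ... | no  _ = length-filter≡count xs

  count-++ : ∀ xs ys → count P? (xs ++ ys) ≡ count P? xs + count P? ys
  count-++ []       ys = refl
  count-++ (x ∷ xs) ys = trans (cong (iverson (P? x) +_) (count-++ xs ys)) (sym (+-assoc (iverson (P? x)) _ _))

  count-map : (f : B → A) (xs : List B) → count P? (map f xs) ≡ count (P? ∘ f) xs
  count-map f []       = refl
  count-map f (x ∷ xs) = cong (iverson (P? (f x)) +_) (count-map f xs)

  count-none : (∀ x → ¬ P x) → ∀ xs → count P? xs ≡ 0
  count-none ¬P []       = refl
  count-none ¬P (x ∷ xs) with P? x
  ... | yes p = contradiction p (¬P x)
  ... | no  _ = count-none ¬P xs

  count-concatMap-tabulate : ∀ {n} (h : Fin n → B) (g : B → List A) →
    count P? (concatMap g (tabulate h)) ≡ ∑[ i < n ] count P? (g (h i))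
  count-concatMap-tabulate {n = zero}  h g = refl
  count-concatMap-tabulate {n = suc n} h g =
    trans (count-++ (g (h zero)) _) (cong (count P? (g (h zero)) +_) (count-concatMap-tabulate (h ∘ suc) g))

  count-×-dec : {Q : Set} (q : Dec Q) → ∀ xs → count (λ x → q ×-dec P? x) xs ≡ iverson q * count P? xs
  count-×-dec q []       = sym (*-zeroʳ (iverson q))
  count-×-dec q (x ∷ xs) =
    trans (cong₂ _+_ (iverson-× q (P? x)) (count-×-dec q xs)) (sym (*-distribˡ-+ (iverson q) _ _))

count-cong : {P Q : A → Set} (P? : Decidable P) (Q? : Decidable Q) → (∀ x → P x ⇔ Q x) →
  ∀ xs → count P? xs ≡ count Q? xs
count-cong P? Q? P⇔Q []       = refl
count-cong P? Q? P⇔Q (x ∷ xs) = cong₂ _+_ (iverson-cong (P? x) (Q? x) (P⇔Q x)) (count-cong P? Q? P⇔Q xs)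

count-allFuns-suc : {P : Vec (Fin n) (suc m) → Set} (P? : Decidable P) →
  count P? (allFuns (suc m) n) ≡ ∑[ i < n ] count (λ f → P? (i ∷ f)) (allFuns m n)
count-allFuns-suc {n} {m} P? = trans (count-concatMap-tabulate P? id (λ i → map (i ∷_) (allFuns m n)))
                                     (sum-cong-≗ (λ i → count-map P? (i ∷_) (allFuns m n)))

AvoidsZero : Vec (Fin (suc n)) m → Set
AvoidsZero f = ∀ i → lookup f i ≢ zero

count-allFuns-avoidingZero : {P : Vec (Fin (suc n)) m → Set} (P? : Decidable P) → (∀ {f} → P f → AvoidsZero f) →
  count P? (allFuns m (suc n)) ≡ count (λ g → P? (Vec.map suc g)) (allFuns m n)
count-allFuns-avoidingZero {m = zero}  P? _     = refl
count-allFuns-avoidingZero {n} {suc m} P? avoid = begin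
    count P? (allFuns (suc m) (suc n))
  ≡⟨ count-allFuns-suc P? ⟩
    count (λ g → P? (zero ∷ g)) (allFuns m (suc n)) + ∑[ i < n ] count (λ g → P? (suc i ∷ g)) (allFuns m (suc n))
  ≡⟨ cong₂ _+_ (count-none (λ g → P? (zero ∷ g)) (λ g p → avoid p zero refl) (allFuns m (suc n)))
               (sum-cong-≗ (λ i → count-allFuns-avoidingZero (λ g → P? (suc i ∷ g)) (λ p j → avoid p (suc j)))) ⟩
    ∑[ i < n ] count (λ g → P? (suc i ∷ Vec.map suc g)) (allFuns m n)
  ≡⟨ count-allFuns-suc (λ g → P? (Vec.map suc g)) ⟨
    count (λ g → P? (Vec.map suc g)) (allFuns (suc m) n)
  ∎
  where open ≡-Reasoning

allFuns-complete : (f : Vec (Fin n) m) → f ∈ allFuns m n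
allFuns-complete []      = here refl
allFuns-complete (i ∷ f) = ∈-concatMap⁺ _ (lose (∈-allFin i) (∈-map⁺ (i ∷_) (allFuns-complete f)))

module _ {x : Fin k} {v : Word k m} {w : Word k n} {i : Fin n} {f : Vec (Fin n) m} where

  IsMap-∷⁻ : IsMap (x ∷ v) w (i ∷ f) → x ≡ lookup w i × (∀ j → i Fin.< lookup f j) × IsMap v w f
  IsMap-∷⁻ (inc , eq) = eq zero , (λ j → inc zero (suc j) z<s) , (λ a b a<b → inc (suc a) (suc b) (s<s a<b)) , eq ∘ suc

  IsMap-∷⁺ : x ≡ lookup w i × (∀ j → i Fin.< lookup f j) × IsMap v w f → IsMap (x ∷ v) w (i ∷ f)
  IsMap-∷⁺ (x≡wi , i<f , f-inc , f-eq) = inc , eq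
    where
    inc : ∀ a b → a Fin.< b → lookup (i ∷ f) a Fin.< lookup (i ∷ f) b
    inc zero    zero    ()
    inc zero    (suc b) _   = i<f b
    inc (suc a) zero    ()
    inc (suc a) (suc b) a<b = f-inc a b (s<s⁻¹ a<b)
    eq : ∀ a → lookup (x ∷ v) a ≡ lookup w (lookup (i ∷ f) a)
    eq zero    = x≡wi
    eq (suc a) = f-eq a

IsMap-∷-avoidsZero : {x : Fin k} {v : Word k m} {w : Word k (suc n)} {i : Fin (suc n)} {f : Vec (Fin (suc n)) m} →
  IsMap (x ∷ v) w (i ∷ f) → AvoidsZero f
IsMap-∷-avoidsZero {w = w} {i} p j f[j]≡0 = n≮0 (subst (i Fin.<_) f[j]≡0 (proj₁ (proj₂ (IsMap-∷⁻ {w = w} p)) j))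

IsMap-map-suc : (v : Word k m) (y : Fin k) (w : Word k n) (f : Vec (Fin n) m) →
  IsMap v (y ∷ w) (Vec.map suc f) ⇔ IsMap v w f
IsMap-map-suc v y w f = mk⇔
  (λ (inc , eq) → (λ a b a<b → s<s⁻¹ (subst₂ Fin._<_ (f[suc] a) (f[suc] b) (inc a b a<b))) ,
                  (λ a → trans (eq a) (cong (lookup (y ∷ w)) (f[suc] a))))
  (λ (inc , eq) → (λ a b a<b → subst₂ Fin._<_ (sym (f[suc] a)) (sym (f[suc] b)) (s<s (inc a b a<b))) ,
                  (λ a → trans (eq a) (cong (lookup (y ∷ w)) (sym (f[suc] a)))))
  where
  f[suc] : ∀ a → lookup (Vec.map suc f) a ≡ suc (lookup f a)
  f[suc] a = lookup-map a suc f

IsMap-zero∷map-suc : (x : Fin k) (v : Word k m) (y : Fin k) (w : Word k n) (g : Vec (Fin n) m) →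
  IsMap (x ∷ v) (y ∷ w) (zero ∷ Vec.map suc g) ⇔ (x ≡ y × IsMap v w g)
IsMap-zero∷map-suc {n = n} x v y w g = mk⇔
  (λ p → let x≡y , _ , g-map = IsMap-∷⁻ {w = y ∷ w} p in x≡y , Equivalence.to (IsMap-map-suc v y w g) g-map)
  (λ (x≡y , g-map) → IsMap-∷⁺ {w = y ∷ w} (x≡y , 0<suc , Equivalence.from (IsMap-map-suc v y w g) g-map))
  where
  0<suc : ∀ j → zero {n} Fin.< lookup (Vec.map suc g) j
  0<suc j = subst (zero {n} Fin.<_) (sym (lookup-map j suc g)) z<s

M-[] : (w : Word k n) → M [] w ≡ 1
M-[] w with isMap? [] w []
... | yes _ = refl
... | no ¬p = contradiction ((λ ()) , (λ ())) ¬p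

M-∷-∷ : (x : Fin k) (v : Word k m) (y : Fin k) (w : Word k n) →
  M (x ∷ v) (y ∷ w) ≡ M (x ∷ v) w + iverson (x ≟ y) * M v w
M-∷-∷ {m = m} {n = n} x v y w = begin
    M (x ∷ v) (y ∷ w)
  ≡⟨ length-filter≡count (isMap? (x ∷ v) (y ∷ w)) (allFuns (suc m) (suc n)) ⟩
    count (isMap? (x ∷ v) (y ∷ w)) (allFuns (suc m) (suc n))
  ≡⟨ count-allFuns-suc (isMap? (x ∷ v) (y ∷ w)) ⟩
    maps-through-0 + maps-avoiding-0
  ≡⟨ +-comm maps-through-0 maps-avoiding-0 ⟩
    maps-avoiding-0 + maps-through-0
  ≡⟨ cong₂ _+_ maps-avoiding-0≡ maps-through-0≡ ⟩
    M (x ∷ v) w + iverson (x ≟ y) * M v w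
  ∎
  where
  open ≡-Reasoning
  maps-through-0 maps-avoiding-0 : ℕ
  maps-through-0  = count (λ g → isMap? (x ∷ v) (y ∷ w) (zero ∷ g)) (allFuns m (suc n))
  maps-avoiding-0 = ∑[ i < n ] count (λ g → isMap? (x ∷ v) (y ∷ w) (suc i ∷ g)) (allFuns m (suc n))
  maps-avoiding-0≡ : maps-avoiding-0 ≡ M (x ∷ v) w
  maps-avoiding-0≡ = begin
      maps-avoiding-0
    ≡⟨ sum-cong-≗ (λ i → trans
         (count-allFuns-avoidingZero (λ g → isMap? (x ∷ v) (y ∷ w) (suc i ∷ g)) (IsMap-∷-avoidsZero {w = y ∷ w}))
         (count-cong _ (λ g → isMap? (x ∷ v) w (i ∷ g)) (λ g → IsMap-map-suc (x ∷ v) y w (i ∷ g)) (allFuns m n))) ⟩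
      ∑[ i < n ] count (λ g → isMap? (x ∷ v) w (i ∷ g)) (allFuns m n)
    ≡⟨ count-allFuns-suc (isMap? (x ∷ v) w) ⟨
      count (isMap? (x ∷ v) w) (allFuns (suc m) n)
    ≡⟨ length-filter≡count (isMap? (x ∷ v) w) (allFuns (suc m) n) ⟨
      M (x ∷ v) w
    ∎
  maps-through-0≡ : maps-through-0 ≡ iverson (x ≟ y) * M v w
  maps-through-0≡ = begin
      maps-through-0
    ≡⟨ count-allFuns-avoidingZero (λ g → isMap? (x ∷ v) (y ∷ w) (zero ∷ g)) (IsMap-∷-avoidsZero {w = y ∷ w}) ⟩
      count (λ g → isMap? (x ∷ v) (y ∷ w) (zero ∷ Vec.map suc g)) (allFuns m n)
    ≡⟨ count-cong _ (λ g → (x ≟ y) ×-dec isMap? v w g) (IsMap-zero∷map-suc x v y w) (allFuns m n) ⟩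
      count (λ g → (x ≟ y) ×-dec isMap? v w g) (allFuns m n)
    ≡⟨ count-×-dec (isMap? v w) (x ≟ y) (allFuns m n) ⟩
      iverson (x ≟ y) * count (isMap? v w) (allFuns m n)
    ≡⟨ cong (iverson (x ≟ y) *_) (length-filter≡count (isMap? v w) (allFuns m n)) ⟨
      iverson (x ≟ y) * M v w
    ∎

sum-mono-≤ : {f g : Fin n → ℕ} → (∀ i → f i ≤ g i) → sum f ≤ sum g
sum-mono-≤ {zero}  _   = z≤n
sum-mono-≤ {suc n} f≤g = +-mono-≤ (f≤g zero) (sum-mono-≤ (f≤g ∘ suc))

C-monoˡ-≤ : ∀ {n n′} k → n ≤ n′ → n C k ≤ n′ C k
C-monoˡ-≤ {n} k n≤n′ = subst (λ n′ → n C k ≤ n′ C k) (m∸n+n≡m n≤n′) (go (_ ∸ n))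
  where
  step : ∀ n k → n C k ≤ suc n C k
  step n zero    = ≤-refl
  step n (suc k) = subst (n C suc k ≤_) (nCk+nC[k+1]≡[n+1]C[k+1] n k) (m≤n+m _ _)
  go : ∀ d → n C k ≤ (d + n) C k
  go zero    = ≤-refl
  go (suc d) = ≤-trans (go d) (step (d + n) k)

hockey-stick : ∀ n k → ∑[ j ≤ n ] ((n ∸ toℕ j + k) C k) ≡ (n + suc k) C suc k
hockey-stick zero    k = trans (+-identityʳ _) (trans (nCn≡1 k) (sym (nCn≡1 (suc k))))
hockey-stick (suc n) k = begin
    (suc n + k) C k + ∑[ j ≤ n ] ((n ∸ toℕ j + k) C k)
  ≡⟨ cong ((suc n + k) C k +_) (trans (hockey-stick n k) (cong (λ t → t C suc k) (+-suc n k))) ⟩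
    (suc n + k) C k + (suc n + k) C suc k
  ≡⟨ nCk+nC[k+1]≡[n+1]C[k+1] (suc n + k) k ⟩
    suc (suc n + k) C suc k
  ≡⟨ cong (λ t → suc t C suc k) (+-suc n k) ⟨
    (suc n + suc k) C suc k
  ∎
  where open ≡-Reasoning

module Occurrences {A : Set} (_≟_ : DecidableEquality A) where

  occ : List A → List A → ℕ
  occ []      _       = 1
  occ (_ ∷ _) []      = 0
  occ (x ∷ v) (y ∷ w) = occ (x ∷ v) w + iverson (x ≟ y) * occ v w

  occ-long : ∀ v w → length w < length v → occ v w ≡ 0
  occ-long (x ∷ v) []      _   = refl
  occ-long (x ∷ v) (y ∷ w) w<v = cong₂ _+_
    (occ-long (x ∷ v) w (m<n⇒m<1+n (s<s⁻¹ w<v)))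
    (trans (cong (iverson (x ≟ y) *_) (occ-long v w (s<s⁻¹ w<v))) (*-zeroʳ (iverson (x ≟ y))))

  occ-++ : ∀ u u′ v → occ v (u ++ u′) ≡ ∑[ j ≤ length v ] (occ (take (toℕ j) v) u * occ (drop (toℕ j) v) u′)
  occ-++ []      u′ []      = refl
  occ-++ []      u′ (x ∷ v) =
    sym (trans (cong₂ _+_ (*-identityˡ _) (sum-replicate-zero (suc (length v)))) (+-identityʳ _))
  occ-++ (y ∷ u) u′ []      = refl
  occ-++ (y ∷ u) u′ (x ∷ v) = begin
      occ (x ∷ v) (u ++ u′) + d * occ v (u ++ u′)
    ≡⟨ cong₂ _+_ (occ-++ u u′ (x ∷ v)) (cong (d *_) (occ-++ u u′ v)) ⟩
      (T₀ + sum F₁) + d * sum F₂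
    ≡⟨ +-assoc T₀ _ _ ⟩
      T₀ + (sum F₁ + d * sum F₂)
    ≡⟨ cong (λ t → T₀ + (sum F₁ + t)) (*-distribˡ-sum d F₂) ⟩
      T₀ + (sum F₁ + ∑[ j ≤ length v ] (d * F₂ j))
    ≡⟨ cong (T₀ +_) (∑-distrib-+ F₁ (λ j → d * F₂ j)) ⟨
      T₀ + ∑[ j ≤ length v ] (F₁ j + d * F₂ j)
    ≡⟨ cong (T₀ +_) (sum-cong-≗ {suc (length v)} (λ j →
         pascal (occ (x ∷ take (toℕ j) v) u) (occ (take (toℕ j) v) u) (occ (drop (toℕ j) v) u′))) ⟩
      T₀ + ∑[ j ≤ length v ] ((occ (x ∷ take (toℕ j) v) u + d * occ (take (toℕ j) v) u) * occ (drop (toℕ j) v) u′)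
    ∎
    where
    open ≡-Reasoning
    d = iverson (x ≟ y)
    T₀ = occ [] u * occ (x ∷ v) u′
    F₁ F₂ : Fin (suc (length v)) → ℕ
    F₁ j = occ (x ∷ take (toℕ j) v) u * occ (drop (toℕ j) v) u′
    F₂ j = occ (take (toℕ j) v) u * occ (drop (toℕ j) v) u′
    pascal : ∀ a b c → a * c + d * (b * c) ≡ (a + d * b) * c
    pascal a b c = trans (cong (a * c +_) (sym (*-assoc d b c))) (sym (*-distribʳ-+ c a (d * b)))

  module _ {u : List A} {b : ℕ} (occ-u≤b : ∀ v → occ v u ≤ b) where

    occ-concat-replicate-≤ : ∀ m v → occ v (List.concat (List.replicate (suc m) u)) ≤ ((length v + m) C m) * b ^ suc m
    occ-concat-replicate-≤ zero v = begin
        occ v (u ++ [])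
      ≡⟨ cong (occ v) (++-identityʳ u) ⟩
        occ v u
      ≤⟨ occ-u≤b v ⟩
        b
      ≡⟨ trans (*-identityˡ (b ^ 1)) (*-identityʳ b) ⟨   -- (l + 0) C 0 computes to 1
        ((length v + 0) C 0) * b ^ 1
      ∎
      where open ≤-Reasoning
    occ-concat-replicate-≤ (suc m) v = begin
        occ v (u ++ R)
      ≡⟨ occ-++ u R v ⟩
        ∑[ j ≤ L ] (occ (take (toℕ j) v) u * occ (drop (toℕ j) v) R)
      ≤⟨ sum-mono-≤ {suc L} (λ j → *-mono-≤ (occ-u≤b (take (toℕ j) v)) (occ-drop≤ (toℕ j))) ⟩
        ∑[ j ≤ L ] (b * (((L ∸ toℕ j + m) C m) * b ^ suc m))
      ≡⟨ sum-cong-≗ {suc L} (λ j → x∙yz≈y∙xz *-commutativeSemigroup b ((L ∸ toℕ j + m) C m) (b ^ suc m)) ⟩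
        ∑[ j ≤ L ] (((L ∸ toℕ j + m) C m) * b ^ suc (suc m))
      ≡⟨ *-distribʳ-sum {suc L} (b ^ suc (suc m)) (λ j → (L ∸ toℕ j + m) C m) ⟨
        (∑[ j ≤ L ] ((L ∸ toℕ j + m) C m)) * b ^ suc (suc m)
      ≡⟨ cong (_* b ^ suc (suc m)) (hockey-stick L m) ⟩
        ((L + suc m) C suc m) * b ^ suc (suc m)
      ∎
      where
      open ≤-Reasoning
      R = List.concat (List.replicate (suc m) u)
      L = length v
      occ-drop≤ : ∀ j → occ (drop j v) R ≤ ((L ∸ j + m) C m) * b ^ suc m
      occ-drop≤ j = subst (λ l → occ (drop j v) R ≤ ((l + m) C m) * b ^ suc m) (length-drop j v)
                          (occ-concat-replicate-≤ m (drop j v))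

open module OccurrencesFin {k : ℕ} = Occurrences (_≟_ {k})

M≡occ : (v : Word k m) (w : Word k n) → M v w ≡ occ (toList v) (toList w)
M≡occ []      w       = M-[] w
M≡occ (x ∷ v) []      = refl
M≡occ (x ∷ v) (y ∷ w) =
  trans (M-∷-∷ x v y w) (cong₂ _+_ (M≡occ (x ∷ v) w) (cong (iverson (x ≟ y) *_) (M≡occ v w)))

M-long : (v : Word k m) (w : Word k n) → n < m → M v w ≡ 0
M-long v w n<m = trans (M≡occ v w)
  (occ-long (toList v) (toList w) (subst₂ _<_ (sym (length-toList w)) (sym (length-toList v)) n<m))

wordsUpTo : ∀ k → ℕ → List (Σ ℕ (Word k))
wordsUpTo k N = concatMap (λ L → map (L ,_) (allFuns L k)) (upTo (suc N))

wordsUpTo-complete : ∀ {L N} → L ≤ N → (v : Word k L) → (L , v) ∈ wordsUpTo k N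
wordsUpTo-complete {k} L≤N v =
  ∈-concatMap⁺ (λ L → map (L ,_) (allFuns L k)) (lose (∈-upTo⁺ (s≤s L≤N)) (∈-map⁺ (_ ,_) (allFuns-complete v)))

M-≤-from-short : (w : Word k n) {r : ℕ} → (∀ {L} (v : Word k L) → L ≤ n → M v w ≤ r) → ∀ L (v : Word k L) → M v w ≤ r
M-≤-from-short {n = n} w short L v with L ≤? n
... | yes L≤n = short v L≤n
... | no  L≰n = subst (_≤ _) (sym (M-long v w (≰⇒> L≰n))) z≤n

IsMaxM-exists : (w : Word k n) → ∃ (IsMaxM w)
IsMaxM-exists {k} {n} w = value best , (proj₁ best , proj₂ best , refl) , M-≤-from-short w best-dominates
  where
  value : Σ ℕ (Word k) → ℕ
  value (_ , v) = M v w
  best : Σ ℕ (Word k)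
  best = argmax value (0 , []) (wordsUpTo k n)
  best-dominates : ∀ {L} (v : Word k L) → L ≤ n → M v w ≤ value best
  best-dominates v L≤n = All.lookup (f[xs]≤f[argmax] {f = value} (0 , []) (wordsUpTo k n)) (wordsUpTo-complete L≤n v)

toList-concat-replicate : ∀ m (w : Vec A n) →
  toList (Vec.concat (Vec.replicate m w)) ≡ List.concat (List.replicate m (toList w))
toList-concat-replicate zero    w = refl
toList-concat-replicate (suc m) w = trans (toList-++ w _) (cong (toList w ++_) (toList-concat-replicate m w))

M-power-≤ : {w : Word k n} {b : ℕ} → (∀ L (u : Word k L) → M u w ≤ b) →
  ∀ m L (v : Word k L) → M v (Vec.concat (Vec.replicate (suc m) w)) ≤ ((suc m * n + m) C m) * b ^ suc m
M-power-≤ {k} {n} {w} {b} M≤b m = M-≤-from-short (Vec.concat (Vec.replicate (suc m) w)) short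
  where
  occ≤b : ∀ a → occ a (toList w) ≤ b
  occ≤b a = subst (λ a → occ a (toList w) ≤ b) (toList∘fromList a)
                  (subst (_≤ b) (M≡occ (fromList a) w) (M≤b _ (fromList a)))
  short : ∀ {L} (v : Word k L) → L ≤ suc m * n →
    M v (Vec.concat (Vec.replicate (suc m) w)) ≤ ((suc m * n + m) C m) * b ^ suc m
  short v L≤mn = begin
      M v (Vec.concat (Vec.replicate (suc m) w))
    ≡⟨ M≡occ v _ ⟩
      occ (toList v) (toList (Vec.concat (Vec.replicate (suc m) w)))
    ≡⟨ cong (occ (toList v)) (toList-concat-replicate (suc m) w) ⟩
      occ (toList v) (List.concat (List.replicate (suc m) (toList w)))
    ≤⟨ occ-concat-replicate-≤ occ≤b m (toList v) ⟩
      ((length (toList v) + m) C m) * b ^ suc m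
    ≤⟨ *-monoˡ-≤ (b ^ suc m) (C-monoˡ-≤ m (+-monoˡ-≤ m (≤-trans (≤-reflexive (length-toList v)) L≤mn))) ⟩
      ((suc m * n + m) C m) * b ^ suc m
    ∎
    where open ≤-Reasoning

IsMaxM-≤ : {w : Word k n} {r B : ℕ} → IsMaxM w r → (∀ L (v : Word k L) → M v w ≤ B) → r ≤ B
IsMaxM-≤ ((_ , v , Mv≡r) , _) M≤B = subst (_≤ _) Mv≡r (M≤B _ v)

IsMk-≤ : ∀ {N a B} → IsMk k N a → (W : Word k N) → (∀ L (v : Word k L) → M v W ≤ B) → a ≤ B
IsMk-≤ (_ , a≤max) W M≤B = ≤-trans (a≤max W _ W-max) (IsMaxM-≤ {w = W} W-max M≤B)
  where W-max = proj₂ (IsMaxM-exists W)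

proposition3 : (k m n : ℕ) → 2 ≤ k → 1 ≤ m → 1 ≤ n →
    (a b : ℕ) → IsMk k (m * n) a → IsMk k n b →
    a ≤ ((m * n + m ∸ 1) C (m ∸ 1)) * b ^ m
proposition3 k (suc m) n _ _ _ a b a-min ((w , _ , M≤b) , _) = begin
    a
  ≤⟨ IsMk-≤ a-min (Vec.concat (Vec.replicate (suc m) w)) (M-power-≤ {w = w} M≤b m) ⟩
    ((suc m * n + m) C m) * b ^ suc m
  ≡⟨ cong (λ t → ((t ∸ 1) C m) * b ^ suc m) (+-suc (suc m * n) m) ⟨
    ((suc m * n + suc m ∸ 1) C m) * b ^ suc m
  ∎
  where open ≤-Reasoning
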